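{- For an integer $n\ge 2$ let $$A_n=\Big\{(x_1,\dots,x_n)\in\mathbb{Z}^n:\ n\ge x_1\ge x_2\ge\cdots\ge x_n\ge 0,\ \sum_{i=1}^k x_i\le 2n+6k-16 \text{ for all } k\in\{1,\dots,n\},\ \text{and } \sum_{i=1}^n x_i\le 6n-12\Big\},$$ and let $S_n(x_1,\dots,x_n)=\sum_{1\le i<j\le n}x_ix_j^2$. If $(x_1,\dots,x_n)\in A_n$ maximizes $S_n$ over $A_n$, then $x_1-x_2\le 1$. -}

module Defs where

open import Data.Nat using (ℕ; zero; suc)
open import Data.Integer using (ℤ; +_; _+_; _-_; _*_; _≤_)
open import Data.Fin using (Fin; zero; suc; toℕ; _<_)
open import Data.Product using (_×_)

-- A point of ℤ^n, indexed by Fin n (index i ↔ paper's x_{i+1}).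
Point : ℕ → Set
Point n = Fin n → ℤ

sumTo : ℕ → (ℕ → ℤ) → ℤ
sumTo zero    f = + 0
sumTo (suc m) f = sumTo m f + f m

-- extend a point to ℕ-indexing (value 0 outside range; only used in range)
at : ∀ {n} → Point n → ℕ → ℤ
at {zero}  x _       = + 0
at {suc n} x zero    = x zero
at {suc n} x (suc i) = at (λ j → x (suc j)) i

prefix : ∀ {n} → Point n → ℕ → ℤ
prefix x k = sumTo k (at x)

InA : (n : ℕ) → Point n → Set
InA n x =
    (∀ (i : Fin n) → x i ≤ + n)
  × (∀ (i j : Fin n) → i < j → x j ≤ x i)
  × (∀ (i : Fin n) → + 0 ≤ x i)
  × (∀ (k : ℕ) → 1 Data.Nat.≤ k → k Data.Nat.≤ n →
       prefix x k ≤ (+ (2 Data.Nat.* n) + + (6 Data.Nat.* k)) - + 16)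
  × (prefix x n ≤ + (6 Data.Nat.* n) - + 12)

S : (n : ℕ) → Point n → ℤ
S n x = sumTo n (λ j → sumTo j (λ i → at x i * (at x j * at x j)))

IsMaximizer : (n : ℕ) → Point n → Set
IsMaximizer n x = InA n x × (∀ (y : Point n) → InA n y → S n y ≤ S n x)

module Submission where

open import Defs
open import Data.Nat using (ℕ; zero; suc; z≤n; s≤s)
import Data.Nat as ℕ
import Data.Nat.Properties as ℕ
open import Data.Fin using (zero; suc)
import Data.Fin as Fin
open import Data.Integer using (ℤ; 0ℤ; nonNegative; +≤+; +_; _+_; _-_; _*_; _≤_; _<_; _≤?_)
open import Data.Integer.Properties
open import Data.Integer.Tactic.RingSolver using (solve-∀)
open import Data.Product using (_,_)
open import Relation.Binary.PropositionalEquality using (_≡_; refl; sym; trans; cong; cong₂; subst; module ≡-Reasoning)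
open import Relation.Nullary using (yes; no; contradiction)

-- If x₁ - x₂ ≥ 2, move one unit from x₁ to x₂. The point stays in A_n: the
-- order is kept, the first prefix sum drops and all longer ones are unchanged.
-- Every term x_i x_j² with j ≥ 3 only sees x₁ + x₂, which is unchanged, while
-- x₁x₂² grows to (x₁ - 1)(x₂ + 1)², by x₂² + 3x₂ + 1 + (x₁ - x₂ - 2)(2x₂ + 1) > 0.

*-nonNeg : ∀ {i j} → 0ℤ ≤ i → 0ℤ ≤ j → 0ℤ ≤ i * j
*-nonNeg {i} 0≤i 0≤j = subst (_≤ i * _) (*-zeroʳ i) (*-monoˡ-≤-nonNeg i {{nonNegative 0≤i}} 0≤j)

square-transfer-excess : ∀ a b → (a - + 1) * ((b + + 1) * (b + + 1)) ≡
  a * (b * b) + (+ 1 + (b * b + (b + b + b) + ((a - + 1) - (b + + 1)) * (b + b + + 1)))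
square-transfer-excess = solve-∀

*-square-transfer-< : ∀ {a b} → 0ℤ ≤ b → b + + 1 ≤ a - + 1 →
  a * (b * b) < (a - + 1) * ((b + + 1) * (b + + 1))
*-square-transfer-< {a} {b} 0≤b b+1≤a-1 = begin-strict
  a * (b * b)                           ≡⟨ sym (+-identityʳ _) ⟩
  a * (b * b) + 0ℤ                      <⟨ +-monoʳ-< (a * (b * b)) (suc[i]≤j⇒i<j (suc-mono 0≤excess-1)) ⟩
  a * (b * b) + (+ 1 + excess-1)        ≡⟨ sym (square-transfer-excess a b) ⟩
  (a - + 1) * ((b + + 1) * (b + + 1))   ∎
  where
  open ≤-Reasoning
  excess-1 : ℤ
  excess-1 = b * b + (b + b + b) + ((a - + 1) - (b + + 1)) * (b + b + + 1)
  0≤excess-1 : 0ℤ ≤ excess-1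
  0≤excess-1 = +-mono-≤ (+-mono-≤ (*-nonNeg 0≤b 0≤b) (+-mono-≤ (+-mono-≤ 0≤b 0≤b) 0≤b))
                        (*-nonNeg (i≤j⇒0≤j-i b+1≤a-1) (+-mono-≤ (+-mono-≤ 0≤b 0≤b) (+≤+ z≤n)))

sumTo-cong : ∀ d {f g : ℕ → ℤ} → (∀ i → f i ≡ g i) → sumTo d f ≡ sumTo d g
sumTo-cong zero    f≗g = refl
sumTo-cong (suc d) f≗g = cong₂ _+_ (sumTo-cong d f≗g) (f≗g d)

sumTo-split : ∀ k d (f : ℕ → ℤ) → sumTo (k ℕ.+ d) f ≡ sumTo k f + sumTo d (λ i → f (k ℕ.+ i))
sumTo-split k zero    f rewrite ℕ.+-identityʳ k = sym (+-identityʳ _)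
sumTo-split k (suc d) f rewrite ℕ.+-suc k d =
  trans (cong (_+ f (k ℕ.+ d)) (sumTo-split k d f)) (+-assoc (sumTo k f) _ _)

module _ (k : ℕ) {f g : ℕ → ℤ} (same-tail : ∀ i → f (k ℕ.+ i) ≡ g (k ℕ.+ i)) where

  sumTo-≡-by-head : sumTo k f ≡ sumTo k g → ∀ d → sumTo (k ℕ.+ d) f ≡ sumTo (k ℕ.+ d) g
  sumTo-≡-by-head heads d = begin
    sumTo (k ℕ.+ d) f                                ≡⟨ sumTo-split k d f ⟩
    sumTo k f + sumTo d (λ i → f (k ℕ.+ i))          ≡⟨ cong₂ _+_ heads (sumTo-cong d same-tail) ⟩
    sumTo k g + sumTo d (λ i → g (k ℕ.+ i))          ≡⟨ sym (sumTo-split k d g) ⟩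
    sumTo (k ℕ.+ d) g                                ∎
    where open ≡-Reasoning

  sumTo-<-by-head : sumTo k f < sumTo k g → ∀ d → sumTo (k ℕ.+ d) f < sumTo (k ℕ.+ d) g
  sumTo-<-by-head heads d = begin-strict
    sumTo (k ℕ.+ d) f                                ≡⟨ sumTo-split k d f ⟩
    sumTo k f + sumTo d (λ i → f (k ℕ.+ i))          <⟨ +-monoˡ-< _ heads ⟩
    sumTo k g + sumTo d (λ i → f (k ℕ.+ i))          ≡⟨ cong (λ t → sumTo k g + t) (sumTo-cong d same-tail) ⟩
    sumTo k g + sumTo d (λ i → g (k ℕ.+ i))          ≡⟨ sym (sumTo-split k d g) ⟩
    sumTo (k ℕ.+ d) g                                ∎
    where open ≤-Reasoning

1<i-j⇒j+1≤i-1 : ∀ {i j} → + 1 < i - j → j + + 1 ≤ i - + 1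
1<i-j⇒j+1≤i-1 {i} {j} 1<i-j = begin
  j + + 1             ≡⟨ split-off-2 j ⟩
  + 2 + (j - + 1)     ≤⟨ +-monoˡ-≤ (j - + 1) (i<j⇒suc[i]≤j 1<i-j) ⟩
  i - j + (j - + 1)   ≡⟨ telescope i j ⟩
  i - + 1             ∎
  where
  open ≤-Reasoning
  split-off-2 : ∀ b → b + + 1 ≡ + 2 + (b - + 1)
  split-off-2 = solve-∀
  telescope : ∀ a b → a - b + (b - + 1) ≡ a - + 1
  telescope = solve-∀

transfer : ∀ {m} → Point (suc (suc m)) → Point (suc (suc m))
transfer x zero          = x zero - + 1
transfer x (suc zero)    = x (suc zero) + + 1
transfer x (suc (suc i)) = x (suc (suc i))

S-term : ∀ {n} → Point n → ℕ → ℤ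
S-term x j = sumTo j (λ i → at x i * (at x j * at x j))

module _ {m : ℕ} (x : Point (suc (suc m))) where

  private
    n : ℕ
    n = suc (suc m)
    x₁ x₂ : ℤ
    x₁ = x zero
    x₂ = x (suc zero)

  prefix-transfer-≤ : ∀ k → prefix (transfer x) k ≤ prefix x k
  prefix-transfer-≤ zero          = ≤-refl
  prefix-transfer-≤ (suc zero)    = +-monoʳ-≤ (+ 0) (i-j≤i x₁ (+ 1))
  prefix-transfer-≤ (suc (suc d)) =
    ≤-reflexive (sumTo-≡-by-head 2 (λ _ → refl) (transfer-keeps-sum x₁ x₂) d)
    where
    transfer-keeps-sum : ∀ a b → + 0 + (a - + 1) + (b + + 1) ≡ + 0 + a + b
    transfer-keeps-sum = solve-∀

  S-transfer-> : 0ℤ ≤ x₂ → x₂ + + 1 ≤ x₁ - + 1 → S n x < S n (transfer x)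
  S-transfer-> 0≤x₂ gap = sumTo-<-by-head 2 same-term first-terms m
    where
    same-term : ∀ j → S-term x (2 ℕ.+ j) ≡ S-term (transfer x) (2 ℕ.+ j)
    same-term j = sumTo-≡-by-head 2 (λ _ → refl) (transfer-keeps-weighted-sum x₁ x₂ _) j
      where
      transfer-keeps-weighted-sum : ∀ a b c → + 0 + a * c + b * c ≡ + 0 + (a - + 1) * c + (b + + 1) * c
      transfer-keeps-weighted-sum = solve-∀
    first-terms : sumTo 2 (S-term x) < sumTo 2 (S-term (transfer x))
    first-terms = +-monoʳ-< (+ 0 + + 0) (+-monoʳ-< (+ 0) (*-square-transfer-< {x₁} 0≤x₂ gap))

  InA-transfer : InA n x → x₂ + + 1 ≤ x₁ - + 1 → InA n (transfer x)
  InA-transfer (≤n , antitone , nonNeg , prefix-bound , total-bound) gap =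
    ≤n′ , antitone′ , nonNeg′ ,
    (λ k 1≤k k≤n → ≤-trans (prefix-transfer-≤ k) (prefix-bound k 1≤k k≤n)) ,
    ≤-trans (prefix-transfer-≤ n) total-bound
    where
    x₁-1≤x₁ : x₁ - + 1 ≤ x₁
    x₁-1≤x₁ = i-j≤i x₁ (+ 1)
    x₂≤x₂+1 : x₂ ≤ x₂ + + 1
    x₂≤x₂+1 = i≤i+j x₂ (+ 1)

    ≤n′ : ∀ i → transfer x i ≤ + n
    ≤n′ zero          = ≤-trans x₁-1≤x₁ (≤n zero)
    ≤n′ (suc zero)    = ≤-trans (≤-trans gap x₁-1≤x₁) (≤n zero)
    ≤n′ (suc (suc i)) = ≤n (suc (suc i))

    antitone′ : ∀ i j → i Fin.< j → transfer x j ≤ transfer x i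
    antitone′ zero          (suc zero)    _   = gap
    antitone′ (suc zero)    (suc (suc j)) _   =
      ≤-trans (antitone (suc zero) (suc (suc j)) (s≤s (s≤s z≤n))) x₂≤x₂+1
    antitone′ zero          (suc (suc j)) _   =
      ≤-trans (antitone′ (suc zero) (suc (suc j)) (s≤s (s≤s z≤n))) gap
    antitone′ (suc (suc i)) (suc (suc j)) i<j = antitone (suc (suc i)) (suc (suc j)) i<j
    antitone′ zero          zero          ()
    antitone′ (suc zero)    zero          ()
    antitone′ (suc zero)    (suc zero)    (s≤s ())
    antitone′ (suc (suc i)) zero          ()
    antitone′ (suc (suc i)) (suc zero)    (s≤s ())

    nonNeg′ : ∀ i → 0ℤ ≤ transfer x i
    nonNeg′ zero          = ≤-trans (nonNeg′ (suc zero)) gap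
    nonNeg′ (suc zero)    = ≤-trans (nonNeg (suc zero)) x₂≤x₂+1
    nonNeg′ (suc (suc i)) = nonNeg (suc (suc i))

lemma2 : (m : ℕ) → (x : Point (suc (suc m))) → IsMaximizer (suc (suc m)) x →
    x zero - x (suc zero) ≤ + 1
lemma2 m x (x∈A@(_ , _ , nonNeg , _) , maximal) with x zero - x (suc zero) ≤? + 1
... | yes x₁-x₂≤1 = x₁-x₂≤1
... | no  x₁-x₂≰1 =
  contradiction (maximal (transfer x) (InA-transfer x x∈A gap))
                (<⇒≱ (S-transfer-> x (nonNeg (suc zero)) gap))
  where
  gap : x (suc zero) + + 1 ≤ x zero - + 1
  gap = 1<i-j⇒j+1≤i-1 {x zero} {x (suc zero)} (≰⇒> x₁-x₂≰1)
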